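{- For every $\varepsilon\in(0,1)$ and $m\in\mathbb{N}$ there exists $M_0$ such that for every $M\ge M_0$ the following holds. Suppose we have nonempty finite sets $\mathcal{P}^{st}$ for $1\le s<t\le M$ and further sets $\mathcal{P}^{st}_{r}\subseteq\mathcal{P}^{st}$ with $|\mathcal{P}^{st}_{r}|\ge\varepsilon|\mathcal{P}^{st}|$ for $1\le r<s<t\le M$. Then there is a subset $Z\subseteq[M]$ of size $m$ and there are elements $P^{st}\in\mathcal{P}^{st}$ for all $s<t$ from $Z$ such that $P^{st}\in\mathcal{P}^{st}_{r}$ for every $r\in Z$ with $r<s$. -}

module Defs where

open import Data.Nat using (ℕ)
open import Data.Integer using (+_)
open import Data.Rational using (ℚ; _/_)

toℚ : ℕ → ℚ
toℚ k = (+ k) / 1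

module Submission where

-- Greedy selection from the top.  Writing ε = (1+a)/(1+d) and q = 1+d, the density
-- hypothesis yields ∣𝒫^{st}∣ ≤ q·∣𝒫^{st}_r∣ (module DensityRatio).  Double counting
-- the incidences "P ∈ 𝒫^{st}_r" then gives an averaging principle: if every 𝒫^{st}_r
-- (r ∈ D) holds a 1/q fraction of 𝒫^{st}, some point P lies in 𝒫^{st}_r for a 1/q
-- fraction of the r ∈ D (module Averaging).
--
-- Z is built from its largest element downwards (module Greedy), together with a
-- decreasing list of candidate indices r compatible with all points chosen so far.
-- The largest candidate s becomes the new smallest element of Z; for each of the j
-- elements t already in Z, P^{st} is chosen by averaging over the remaining
-- candidates, each time keeping a 1/q fraction of them.  Hence a configuration of
-- size j needs q^j times as many candidates for the next step, and
-- M₀ = needed q m 0 suffices.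

module DensityRatio where
  open import Defs
  open import Data.Nat using (ℕ; zero; suc; _*_; _≤_)
  open import Data.Nat.Properties using (≤-trans; m≤n*m; *-identityʳ; *-comm)
  import Data.Nat.Coprimality as Coprime
  open import Data.Integer as ℤ using (+_; +[1+_]; -[1+_])
  import Data.Integer.Properties as ℤ
  open import Data.Rational as ℚ using (ℚ; mkℚ; 0ℚ) renaming (_<_ to _<ℚ_; _≤_ to _≤ℚ_)
  import Data.Rational.Properties as ℚ
  import Data.Rational.Unnormalised as ℚᵘ
  import Data.Rational.Unnormalised.Properties as ℚᵘ
  open import Data.Product using (∃; _,_)
  open import Relation.Binary.PropositionalEquality

  whole : ℕ → ℚ
  whole k = mkℚ (+ k) 0 (Coprime.sym (Coprime.1-coprimeTo k))

  toℚ-whole : ∀ k → toℚ k ≡ whole k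
  toℚ-whole k = ℚ.normalize-coprime (Coprime.sym (Coprime.1-coprimeTo k))

  -- A density ε > 0 can be replaced by an integer ratio: writing ε = (1+a)/(1+d),
  -- the inequality ε·n ≤ c forces n ≤ (1+d)·c.
  densityRatio : ∀ ε → 0ℚ <ℚ ε → ∃ λ d → ∀ n c → ε ℚ.* toℚ n ≤ℚ toℚ c → n ≤ suc d * c
  densityRatio (mkℚ (+ zero) d _) (ℚ.*<* (ℤ.+<+ ()))
  densityRatio (mkℚ -[1+ _ ] d _) (ℚ.*<* ())
  densityRatio ε@(mkℚ +[1+ a ] d _) _ = d , bound
    where
    unnormalised : ∀ n c → ε ℚ.* toℚ n ≤ℚ toℚ c →
                   ℚᵘ.mkℚᵘ +[1+ a ] d ℚᵘ.* ℚᵘ.mkℚᵘ (+ n) 0 ℚᵘ.≤ ℚᵘ.mkℚᵘ (+ c) 0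
    unnormalised n c εn≤c = ℚᵘ.≤-respˡ-≃ (ℚ.toℚᵘ-homo-* ε (whole n))
      (ℚ.toℚᵘ-mono-≤ (subst₂ _≤ℚ_ (cong (ε ℚ.*_) (toℚ-whole n)) (toℚ-whole c) εn≤c))
    bound : ∀ n c → ε ℚ.* toℚ n ≤ℚ toℚ c → n ≤ suc d * c
    bound n c εn≤c with unnormalised n c εn≤c
    ... | ℚᵘ.*≤* cross = ≤-trans (m≤n*m n (suc a)) (ℤ.drop‿+≤+ (subst₂ ℤ._≤_ lhs rhs cross))
      where
      -- cross-multiplying gives (1+a)·n ≤ (1+d)·c, read off in ℕ
      lhs : (+[1+ a ] ℤ.* + n) ℤ.* + 1 ≡ + (suc a * n)
      lhs = trans (ℤ.*-identityʳ _) (sym (ℤ.pos-* (suc a) n))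
      rhs : + c ℤ.* + (suc d * 1) ≡ + (suc d * c)
      rhs = trans (sym (ℤ.pos-* c _))
                  (cong +_ (trans (cong (c *_) (*-identityʳ (suc d))) (*-comm c (suc d))))

module Averaging where
  open import Data.Nat using (ℕ; zero; suc; _+_; _*_; _≤_; _<_; z≤n; _≤?_)
  open import Data.Nat.Properties
  open import Data.Bool using (true; false; if_then_else_)
  open import Data.Fin using (Fin; zero; suc)
  open import Data.Fin.Subset using (Subset; ∣_∣; _∈_; inside; outside)
  open import Data.Fin.Subset.Properties using (_∈?_)
  open import Data.Vec using (_∷_; [])
  open import Data.List using (List; []; _∷_; length; filter)
  open import Data.List.Relation.Unary.All using (All; []; _∷_)
  open import Data.List.Relation.Unary.All.Properties using (all-filter)
  open import Data.List.Relation.Binary.Sublist.Propositional using (_⊆_)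
  open import Data.List.Relation.Binary.Sublist.Setoid.Properties using (filter-⊆)
  open import Data.Product using (∃; _×_; _,_)
  import Data.Product as Product
  open import Function using (_∘_; id)
  open import Relation.Nullary using (Dec; does; yes; no)
  open import Relation.Binary.PropositionalEquality
  open import Algebra.Properties.CommutativeMonoid.Sum +-0-commutativeMonoid
    using (sum-cong-≗; ∑-distrib-+; sum-syntax)

  open ≤-Reasoning

  𝟙 : ∀ {p} {P : Set p} → Dec P → ℕ
  𝟙 P? = if does P? then 1 else 0

  ∑-𝟙-∈ : ∀ {N} (p : Subset N) → ∑[ x < N ] 𝟙 (x ∈? p) ≡ ∣ p ∣
  ∑-𝟙-∈ []            = refl
  ∑-𝟙-∈ (inside ∷ p)  = cong suc (∑-𝟙-∈ p)
  ∑-𝟙-∈ (outside ∷ p) = ∑-𝟙-∈ p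

  length-filter-∷ : ∀ {a p} {A : Set a} {P : A → Set p} (P? : ∀ x → Dec (P x)) x xs →
                    length (filter P? (x ∷ xs)) ≡ 𝟙 (P? x) + length (filter P? xs)
  length-filter-∷ P? x xs with does (P? x)
  ... | true  = refl
  ... | false = refl

  pigeonhole : ∀ {N} L q (f : Fin (suc N) → ℕ) →
               L * suc N ≤ q * ∑[ x < suc N ] f x → ∃ λ x → L ≤ q * f x
  pigeonhole {zero} L q f h = zero , (begin
    L                ≡⟨ *-identityʳ L ⟨
    L * 1            ≤⟨ h ⟩
    q * (f zero + 0) ≡⟨ cong (q *_) (+-identityʳ (f zero)) ⟩
    q * f zero       ∎)
  pigeonhole {suc N} L q f h with L ≤? q * f zero
  ... | yes L≤qf₀ = zero , L≤qf₀
  ... | no  L≰qf₀ = Product.map suc id (pigeonhole L q (f ∘ suc) tailBound)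
    where
    rest = ∑[ x < suc N ] f (suc x)
    -- the first term falls short of L, so the remaining terms carry the deficit
    tailBound : L * suc N ≤ q * rest
    tailBound = +-cancelˡ-≤ L _ _ (begin
      L + L * suc N         ≡⟨ *-suc L (suc N) ⟨
      L * suc (suc N)       ≤⟨ h ⟩
      q * (f zero + rest)   ≡⟨ *-distribˡ-+ q (f zero) rest ⟩
      q * f zero + q * rest ≤⟨ +-monoˡ-≤ (q * rest) (<⇒≤ (≰⇒> L≰qf₀)) ⟩
      L + q * rest          ∎)

  module _ {a} {A : Set a} {N : ℕ} (S : A → Subset N) where

    holders : Fin N → List A → List A
    holders x = filter (λ r → x ∈? S r)

    incidences-∷ : ∀ r D → ∑[ x < N ] length (holders x (r ∷ D)) ≡
                           ∣ S r ∣ + ∑[ x < N ] length (holders x D)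
    incidences-∷ r D = begin-equality
      ∑[ x < N ] length (holders x (r ∷ D))
        ≡⟨ sum-cong-≗ (λ x → length-filter-∷ (λ r → x ∈? S r) r D) ⟩
      ∑[ x < N ] (𝟙 (x ∈? S r) + length (holders x D))
        ≡⟨ ∑-distrib-+ (λ x → 𝟙 (x ∈? S r)) (λ x → length (holders x D)) ⟩
      ∑[ x < N ] 𝟙 (x ∈? S r) + ∑[ x < N ] length (holders x D)
        ≡⟨ cong (_+ ∑[ x < N ] length (holders x D)) (∑-𝟙-∈ (S r)) ⟩
      ∣ S r ∣ + ∑[ x < N ] length (holders x D) ∎

    incidenceBound : ∀ q {D} → All (λ r → N ≤ q * ∣ S r ∣) D →
                     length D * N ≤ q * ∑[ x < N ] length (holders x D)
    incidenceBound q []                 = z≤n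
    incidenceBound q {r ∷ D} (N≤qSr ∷ dense) = begin
      N + length D * N
        ≤⟨ +-mono-≤ N≤qSr (incidenceBound q dense) ⟩
      q * ∣ S r ∣ + q * ∑[ x < N ] length (holders x D)
        ≡⟨ *-distribˡ-+ q ∣ S r ∣ _ ⟨
      q * (∣ S r ∣ + ∑[ x < N ] length (holders x D))
        ≡⟨ cong (q *_) (incidences-∷ r D) ⟨
      q * ∑[ x < N ] length (holders x (r ∷ D)) ∎

  averaging : ∀ {a} {A : Set a} {N} q → 0 < N → (S : A → Subset N) (D : List A) →
              All (λ r → N ≤ q * ∣ S r ∣) D →
              ∃ λ x → ∃ λ D′ → D′ ⊆ D × All (λ r → x ∈ S r) D′ × length D ≤ q * length D′
  averaging {N = suc N} q _ S D dense
    with x , many ← pigeonhole (length D) q (λ x → length (holders S x D)) (incidenceBound S q dense)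
    = x , holders S x D , filter-⊆ (setoid _) (λ r → x ∈? S r) D , all-filter (λ r → x ∈? S r) D , many

module Greedy where
  open Averaging using (averaging)
  open import Data.Nat using (ℕ; zero; suc; _+_; _*_; _^_; _≤_; _<_; _>_; z≤n; s≤s; NonZero)
  open import Data.Nat.Properties
  open import Data.Fin using (Fin; zero; suc) renaming (_<_ to _<ᶠ_)
  open import Data.Fin.Subset using (Subset; ∣_∣; _∈_)
  open import Data.List using (List; _∷_; length; applyDownFrom)
  open import Data.List.Properties using (length-applyDownFrom)
  open import Data.List.Relation.Unary.All as All using (All; []; _∷_)
  import Data.List.Relation.Unary.All.Properties as All
  open import Data.List.Relation.Unary.AllPairs using (AllPairs; []; _∷_)
  import Data.List.Relation.Unary.AllPairs.Properties as AllPairs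
  open import Data.List.Relation.Binary.Sublist.Propositional using (_⊆_; []; _∷_; _∷ʳ_; ⊆-refl; ⊆-trans)
  open import Data.List.Relation.Binary.Sublist.Propositional.Properties using (All-resp-⊆)
  open import Data.Product using (Σ; ∃; _×_; _,_; proj₂)
  open import Relation.Binary.PropositionalEquality
  open import Function using (_∘_)

  AllPairs-resp-⊆ : ∀ {a r} {A : Set a} {R : A → A → Set r} {xs ys : List A} →
                    xs ⊆ ys → AllPairs R ys → AllPairs R xs
  AllPairs-resp-⊆ []          []         = []
  AllPairs-resp-⊆ (_ ∷ʳ τ)    (_ ∷ Rys)  = AllPairs-resp-⊆ τ Rys
  AllPairs-resp-⊆ (refl ∷ τ)  (Ry ∷ Rys) = All-resp-⊆ τ Ry ∷ AllPairs-resp-⊆ τ Rys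

  -- the number of candidates needed to extend a configuration of size j by k further
  -- elements, when each new element costs a factor q per already chosen element
  needed : ℕ → ℕ → ℕ → ℕ
  needed q zero    j = 0
  needed q (suc k) j = suc (q ^ j * needed q k (suc j))

  module Construction
    (M : ℕ) (n : ℕ → ℕ → ℕ)
    (n-pos : ∀ s t → 1 ≤ s → s < t → t ≤ M → 0 < n s t)
    (𝒫 : ∀ r s t → Subset (n s t))
    (q : ℕ) .{{_ : NonZero q}}
    (dense : ∀ r s t → 1 ≤ r → r < s → s < t → t ≤ M → n s t ≤ q * ∣ 𝒫 r s t ∣)
    where

    -- Choosing the points of a whole new row (s, t₀), …, (s, t_{j-1}) at once: every
    -- choice keeps a 1/q fraction of the candidates r < s, so a q^j fraction survives.
    chooseRow : ∀ {j} s (t : Fin j → ℕ) → 1 ≤ s → (∀ i → s < t i × t i ≤ M) →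
                (D : List ℕ) → All (λ r → 1 ≤ r × r < s) D →
                Σ ((i : Fin j) → Fin (n s (t i))) λ X → ∃ λ D′ →
                  D′ ⊆ D × All (λ r → ∀ i → X i ∈ 𝒫 r s (t i)) D′ × length D ≤ q ^ j * length D′
    chooseRow {zero} s t _ _ D _ =
      (λ ()) , D , ⊆-refl , All.universal (λ _ ()) D , ≤-reflexive (sym (*-identityˡ (length D)))
    chooseRow {suc j} s t 1≤s st D lowD
      with s<t₀ , t₀≤M ← st zero
      with x₀ , D₁ , D₁⊆D , x₀∈ , shrink₁ ←
             averaging q (n-pos s (t zero) 1≤s s<t₀ t₀≤M) (λ r → 𝒫 r s (t zero)) D
               (All.map (λ {r} (1≤r , r<s) → dense r s (t zero) 1≤r r<s s<t₀ t₀≤M) lowD)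
      with X , D₂ , D₂⊆D₁ , X∈ , shrink₂ ←
             chooseRow s (t ∘ suc) 1≤s (st ∘ suc) D₁ (All-resp-⊆ D₁⊆D lowD)
      = row , D₂ , ⊆-trans D₂⊆D₁ D₁⊆D , All.zipWith inRow (All-resp-⊆ D₂⊆D₁ x₀∈ , X∈) , shrink
      where
      row : (i : Fin (suc j)) → Fin (n s (t i))
      row zero    = x₀
      row (suc i) = X i
      inRow : ∀ {r} → x₀ ∈ 𝒫 r s (t zero) × (∀ i → X i ∈ 𝒫 r s (t (suc i))) → ∀ i → row i ∈ 𝒫 r s (t i)
      inRow (x₀∈ , X∈) zero    = x₀∈
      inRow (x₀∈ , X∈) (suc i) = X∈ i
      shrink : length D ≤ q ^ suc j * length D₂
      shrink = begin
        length D                 ≤⟨ shrink₁ ⟩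
        q * length D₁            ≤⟨ *-monoʳ-≤ q shrink₂ ⟩
        q * (q ^ j * length D₂)  ≡⟨ *-assoc q (q ^ j) _ ⟨
        q ^ suc j * length D₂    ∎
        where open ≤-Reasoning

    record Configuration (j : ℕ) : Set where
      field
        z         : Fin j → ℕ
        z-mono    : ∀ i i' → i <ᶠ i' → z i < z i'
        z-range   : ∀ i → 1 ≤ z i × z i ≤ M
        P         : ∀ i i' → i <ᶠ i' → Fin (n (z i) (z i'))
        P-good    : ∀ k i i' → (k<i : k <ᶠ i) → (i<i' : i <ᶠ i') → P i i' i<i' ∈ 𝒫 (z k) (z i) (z i')

    open Configuration

    record Admissible {j} (cfg : Configuration j) (r : ℕ) : Set where
      field
        positive   : 1 ≤ r
        bounded    : r ≤ M
        below      : ∀ i → r < z cfg i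
        compatible : ∀ i i' (i<i' : i <ᶠ i') → P cfg i i' i<i' ∈ 𝒫 r (z cfg i) (z cfg i')

    open Admissible

    extend : ∀ {j} (cfg : Configuration j) s → Admissible cfg s →
             ((i : Fin j) → Fin (n s (z cfg i))) → Configuration (suc j)
    extend cfg s adm X = record { z = z′ ; z-mono = mono ; z-range = range ; P = P′ ; P-good = good }
      where
      z′ : Fin _ → ℕ
      z′ zero    = s
      z′ (suc i) = z cfg i
      mono : ∀ i i' → i <ᶠ i' → z′ i < z′ i'
      mono zero    (suc i') _         = below adm i'
      mono (suc i) (suc i') (s≤s i<i') = z-mono cfg i i' i<i'
      range : ∀ i → 1 ≤ z′ i × z′ i ≤ M
      range zero    = positive adm , bounded adm
      range (suc i) = z-range cfg i
      P′ : ∀ i i' → i <ᶠ i' → Fin (n (z′ i) (z′ i'))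
      P′ zero    (suc i') _          = X i'
      P′ (suc i) (suc i') (s≤s i<i') = P cfg i i' i<i'
      good : ∀ k i i' → (k<i : k <ᶠ i) → (i<i' : i <ᶠ i') → P′ i i' i<i' ∈ 𝒫 (z′ k) (z′ i) (z′ i')
      good zero    (suc i) (suc i') _          (s≤s i<i') = compatible adm i i' i<i'
      good (suc k) (suc i) (suc i') (s≤s k<i) (s≤s i<i') = P-good cfg k i i' k<i i<i'

    extend-admissible : ∀ {j} {cfg : Configuration j} {s} (adm : Admissible cfg s)
                          {X : (i : Fin j) → Fin (n s (z cfg i))} {r} →
                        Admissible cfg r → r < s → (∀ i → X i ∈ 𝒫 r s (z cfg i)) →
                        Admissible (extend cfg s adm X) r
    extend-admissible {cfg = cfg} {s} adm {X} {r} admr r<s X∈ = record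
      { positive = positive admr ; bounded = bounded admr ; below = below′ ; compatible = compatible′ }
      where
      cfg′ = extend cfg s adm X
      below′ : ∀ i → r < z cfg′ i
      below′ zero    = r<s
      below′ (suc i) = below admr i
      compatible′ : ∀ i i' (i<i' : i <ᶠ i') → P cfg′ i i' i<i' ∈ 𝒫 r (z cfg′ i) (z cfg′ i')
      compatible′ zero    (suc i') _          = X∈ i'
      compatible′ (suc i) (suc i') (s≤s i<i') = compatible admr i i' i<i'

    -- Candidates are kept in decreasing order so that the head is the largest.
    grow : ∀ k {j} (cfg : Configuration j) (C : List ℕ) → AllPairs _>_ C →
           All (Admissible cfg) C → needed q k j ≤ length C → Configuration (k + j)
    grow zero    cfg C _ _ _ = cfg
    grow (suc k) {j} cfg (s ∷ C) (s>C ∷ decreasing) (adm ∷ admC) (s≤s enough)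
      with X , C′ , C′⊆C , X∈ , shrink ←
             chooseRow s (z cfg) (positive adm) (λ i → below adm i , proj₂ (z-range cfg i)) C
               (All.zipWith (λ (admr , r<s) → positive admr , r<s) (admC , s>C))
      = subst Configuration (+-suc k j)
          (grow k (extend cfg s adm X) C′ (AllPairs-resp-⊆ C′⊆C decreasing) admC′ enough′)
      where
      admC′ : All (Admissible (extend cfg s adm X)) C′
      admC′ = All.zipWith (λ ((admr , r<s) , Xr) → extend-admissible adm admr r<s Xr)
                (All.zip (All-resp-⊆ C′⊆C admC , All-resp-⊆ C′⊆C s>C) , X∈)
      enough′ : needed q k (suc j) ≤ length C′
      enough′ = *-cancelˡ-≤ (q ^ j) {{m^n≢0 q j}} (≤-trans enough shrink)

    empty : Configuration 0
    empty = record { z = λ () ; z-mono = λ () ; z-range = λ () ; P = λ () ; P-good = λ () }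

    allIndices : List ℕ
    allIndices = applyDownFrom suc M

    configuration : ∀ m → needed q m 0 ≤ M → Configuration m
    configuration m enough = subst Configuration (+-identityʳ m)
      (grow m empty allIndices
        (AllPairs.applyDownFrom⁺₁ suc M (λ j<i _ → s≤s j<i))
        (All.applyDownFrom⁺₁ suc M (λ i<M → record
          { positive = s≤s z≤n ; bounded = i<M ; below = λ () ; compatible = λ () }))
        (subst (needed q m 0 ≤_) (sym (length-applyDownFrom suc M)) enough))

open import Defs
open import Data.Nat using (ℕ; suc; _<_; _≤_)
open import Data.Fin using (Fin)
open import Data.Fin.Subset using (Subset; _∈_; ∣_∣)
open import Data.Rational using (ℚ; 0ℚ; 1ℚ; _*_) renaming (_<_ to _<ℚ_; _≤_ to _≤ℚ_)
open import Data.Product using (Σ; ∃; _×_; _,_)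
import Data.Fin
open DensityRatio using (densityRatio)
open Greedy using (needed; module Construction)

corollary4p3 : (ε : ℚ) → 0ℚ <ℚ ε → ε <ℚ 1ℚ → (m : ℕ) →
  ∃ λ (M₀ : ℕ) → (M : ℕ) → M₀ ≤ M →
  (n : ℕ → ℕ → ℕ) →
  ((s t : ℕ) → 1 ≤ s → s < t → t ≤ M → 0 < n s t) →
  (𝒫 : (r s t : ℕ) → Subset (n s t)) →
  ((r s t : ℕ) → 1 ≤ r → r < s → s < t → t ≤ M →
    ε * toℚ (n s t) ≤ℚ toℚ ∣ 𝒫 r s t ∣) →
  Σ (Fin m → ℕ) λ z →
    ((i j : Fin m) → Data.Fin._<_ i j → z i < z j) ×
    ((i : Fin m) → 1 ≤ z i × z i ≤ M) ×
    Σ ((i j : Fin m) → Data.Fin._<_ i j → Fin (n (z i) (z j))) λ P →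
      (k i j : Fin m) → (k<i : Data.Fin._<_ k i) → (i<j : Data.Fin._<_ i j) →
        P i j i<j ∈ 𝒫 (z k) (z i) (z j)

corollary4p3 ε 0<ε _ m with d , ratio ← densityRatio ε 0<ε =
  needed (suc d) m 0 , λ M M₀≤M n n-pos 𝒫 ε-dense →
    let open Construction M n n-pos 𝒫 (suc d)
               (λ r s t 1≤r r<s s<t t≤M → ratio (n s t) ∣ 𝒫 r s t ∣ (ε-dense r s t 1≤r r<s s<t t≤M))
        open Configuration (configuration m M₀≤M)
    in z , z-mono , z-range , P , P-good
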